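{- For every $a\in\mathcal{A}$ and $M\in\mathcal{M}$, the operator $[M]_a$ is a negation-complete, disjunctive KD45-modality in LDiiP; that is, for all formulas $\phi,\phi'$: (K) $\vdash [M]_a(\phi\rightarrow\phi')\rightarrow([M]_a\phi\rightarrow[M]_a\phi')$; (D) $\vdash \neg[M]_a\mathrm{false}$; (4) $\vdash [M]_a\phi\rightarrow[M]_a[M]_a\phi$; (5) $\vdash \neg[M]_a\phi\rightarrow[M]_a\neg[M]_a\phi$; (necessitation) if $\vdash\phi$ then $\vdash[M]_a\phi$; (negation completeness) $\vdash [M]_a\phi\lor[M]_a\neg\phi$; (disjunction property) $\vdash [M]_a(\phi\lor\phi')\rightarrow([M]_a\phi\lor[M]_a\phi')$.
   Context: Let $\mathcal{A}$ be a non-empty finite set of agent names and $\mathcal{M}$ a set of message terms with $\mathcal{A}\subseteq\mathcal{M}$. Let $\mathcal{P}$ be a countable set of propositional variables which contains, for every $a\in\mathcal{A}$ and $M\in\mathcal{M}$, a distinguished atom $\mathsf{k}_a(M)$ (read "$a$ knows $M$"). Formulas of LDiiP are given by $\phi ::= P \mid \neg\phi \mid \phi\land\phi \mid [M]_a\phi$ with $P\in\mathcal{P}$, $M\in\mathcal{M}$, $a\in\mathcal{A}$. Abbreviations: $\mathrm{true}:=[a]_a\mathsf{k}_a(a)$, $\mathrm{false}:=\neg\mathrm{true}$, and $\lor,\rightarrow,\leftrightarrow$ defined classically from $\neg,\land$. LDiiP is the smallest set of formulas that contains (i) all instances of an adequate axiom set for classical propositional logic, (ii) a fixed (arbitrary)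 set $\Gamma_1$ of formulas (axioms about the atoms $\mathsf{k}_a(M)$), (iii) all instances, for all $M\in\mathcal{M}$, $a\in\mathcal{A}$ and formulas $\phi,\phi'$, of: $[M]_a\mathsf{k}_a(M)$ (self-knowledge); $[M]_a(\phi\rightarrow\phi')\rightarrow([M]_a\phi\rightarrow[M]_a\phi')$ (K); $[M]_a\phi\rightarrow(\mathsf{k}_a(M)\rightarrow\phi)$ (epistemic truthfulness); $\neg[M]_a\mathrm{false}$ (proof consistency); $[M]_a\phi\lor[M]_a\neg\phi$ (negation completeness); and which is closed under modus ponens and necessitation (from $\phi$ infer $[M]_a\phi$, for any $M\in\mathcal{M}$, $a\in\mathcal{A}$). Write $\vdash\phi$ for $\phi\in\mathrm{LDiiP}$. -}

module Defs where

open import Data.Bool using (Bool; true; false; not; _∧_)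
open import Data.Nat using (ℕ)
open import Data.Fin using (Fin)
open import Data.Product using (Σ; _×_; _,_)
open import Relation.Binary.PropositionalEquality using (_≡_)
open import Function.Bundles using (_↔_)
open import Function.Definitions using (Injective)

-- Formulas of LDiiP over agents A, messages M, propositional variables P.
-- box M a φ  is  [M]_a φ.
data Formula (A M P : Set) : Set where
  atom : P → Formula A M P
  neg  : Formula A M P → Formula A M P
  conj : Formula A M P → Formula A M P → Formula A M P
  box  : M → A → Formula A M P → Formula A M P

Finite : Set → Set
Finite X = Σ ℕ (λ n → X ↔ Fin n)

Countable : Set → Set
Countable X = Σ (X → ℕ) (λ f → Injective _≡_ _≡_ f)

module _ {A M P : Set} where

  _⇒_ : Formula A M P → Formula A M P → Formula A M P
  φ ⇒ ψ = neg (conj φ (neg ψ))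

  _∨_ : Formula A M P → Formula A M P → Formula A M P
  φ ∨ ψ = neg (conj (neg φ) (neg ψ))

  -- Propositional tautologies (in which atoms and formulas [M]_a φ are
  -- treated as propositional letters).  The set of all tautology instances
  -- is our (adequate) axiom set for classical propositional logic.
  eval : (Formula A M P → Bool) → Formula A M P → Bool
  eval v (atom p)    = v (atom p)
  eval v (neg φ)     = not (eval v φ)
  eval v (conj φ ψ)  = eval v φ ∧ eval v ψ
  eval v (box m a φ) = v (box m a φ)

  Tautology : Formula A M P → Set
  Tautology φ = (v : Formula A M P → Bool) → eval v φ ≡ true

-- Everything depending on the embedding of agents into messages (ag),
-- the distinguished atoms k_a(M) (k), and the agent a₀ used in the
-- definition true := [a₀]_{a₀} k_{a₀}(a₀).
module LDiiP {A M P : Set} (ag : A → M) (k : A → M → P) (a₀ : A) where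

  kn : A → M → Formula A M P
  kn a m = atom (k a m)

  ⊤f : Formula A M P
  ⊤f = box (ag a₀) a₀ (kn a₀ (ag a₀))

  ⊥f : Formula A M P
  ⊥f = neg ⊤f

  data _⊢_ (Γ₁ : Formula A M P → Set) : Formula A M P → Set where
    taut     : ∀ {φ} → Tautology φ → Γ₁ ⊢ φ
    ax       : ∀ {φ} → Γ₁ φ → Γ₁ ⊢ φ
    selfK    : ∀ m a → Γ₁ ⊢ box m a (kn a m)
    K        : ∀ m a φ ψ → Γ₁ ⊢ (box m a (φ ⇒ ψ) ⇒ (box m a φ ⇒ box m a ψ))
    truth    : ∀ m a φ → Γ₁ ⊢ (box m a φ ⇒ (kn a m ⇒ φ))
    cons     : ∀ m a → Γ₁ ⊢ neg (box m a ⊥f)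
    negcompl : ∀ m a φ → Γ₁ ⊢ (box m a φ ∨ box m a (neg φ))
    mp       : ∀ {φ ψ} → Γ₁ ⊢ (φ ⇒ ψ) → Γ₁ ⊢ φ → Γ₁ ⊢ ψ
    nec      : ∀ {φ} m a → Γ₁ ⊢ φ → Γ₁ ⊢ box m a φ

  NegComplDisjKD45 : (Γ₁ : Formula A M P → Set) → M → A → Set
  NegComplDisjKD45 Γ₁ m a =
    (∀ φ φ' → Γ₁ ⊢ (box m a (φ ⇒ φ') ⇒ (box m a φ ⇒ box m a φ')))
    × (Γ₁ ⊢ neg (box m a ⊥f))
    × (∀ φ → Γ₁ ⊢ (box m a φ ⇒ box m a (box m a φ)))
    × (∀ φ → Γ₁ ⊢ (neg (box m a φ) ⇒ box m a (neg (box m a φ))))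
    × (∀ φ → Γ₁ ⊢ φ → Γ₁ ⊢ box m a φ)
    × (∀ φ → Γ₁ ⊢ (box m a φ ∨ box m a (neg φ)))
    × (∀ φ φ' → Γ₁ ⊢ (box m a (φ ∨ φ') ⇒ (box m a φ ∨ box m a φ')))

-- [M]_a is a normal modality by K and necessitation, and serial by proof
-- consistency.  Negation completeness turns ¬[M]_a φ into [M]_a ¬φ, so the
-- remaining laws reduce to consistency plus the principle [M]_a [M]_a ψ →
-- [M]_a ψ, which holds because [M]_a knows k_a(M) (self-knowledge) and
-- k_a(M) together with [M]_a ψ gives ψ (epistemic truthfulness).  Axiom 4 is
-- then the contrapositive of ¬[M]_a[M]_a φ → [M]_a¬[M]_a φ → [M]_a[M]_a¬φ →
-- [M]_a¬φ → ¬[M]_a φ, axiom 5 is symmetric, and the disjunction property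
-- follows from [M]_a¬φ ∧ [M]_a¬φ' → [M]_a¬(φ ∨ φ') and consistency.
module Submission where

open import Defs
open import Data.Bool using (Bool; true; false; not; _∧_; T)
open import Data.Bool.Properties using (T-∧; T-≡)
open import Data.Empty using (⊥)
open import Data.Fin using (Fin; zero; suc)
open import Data.Nat using (ℕ; zero; suc)
open import Data.Product using (_×_; _,_; proj₁; proj₂)
open import Data.Vec using (Vec; []; _∷_; lookup; map)
open import Data.Vec.Properties using (lookup-map)
open import Function using (_∘_)
open import Function.Bundles using (Equivalence)
open import Function.Definitions using (Injective)
open import Relation.Binary.PropositionalEquality using (_≡_; refl; sym; trans; cong; cong₂)

-- Propositional schemata: box-free formulas over n metavariables.
Schema : ℕ → Set
Schema n = Formula ⊥ ⊥ (Fin n)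

module _ {n : ℕ} where

  evalSchema : Vec Bool n → Schema n → Bool
  evalSchema ρ (atom i)   = lookup ρ i
  evalSchema ρ (neg s)    = not (evalSchema ρ s)
  evalSchema ρ (conj s t) = evalSchema ρ s ∧ evalSchema ρ t
  evalSchema ρ (box () _ _)

  _⟦_⟧ : {A M P : Set} → Schema n → Vec (Formula A M P) n → Formula A M P
  atom i   ⟦ σ ⟧ = lookup σ i
  neg s    ⟦ σ ⟧ = neg (s ⟦ σ ⟧)
  conj s t ⟦ σ ⟧ = conj (s ⟦ σ ⟧) (t ⟦ σ ⟧)
  box () _ _ ⟦ σ ⟧

  eval-⟦⟧ : {A M P : Set} (v : Formula A M P → Bool) (σ : Vec (Formula A M P) n)
            (s : Schema n) → eval v (s ⟦ σ ⟧) ≡ evalSchema (map (eval v) σ) s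
  eval-⟦⟧ v σ (atom i)   = sym (lookup-map i (eval v) σ)
  eval-⟦⟧ v σ (neg s)    = cong not (eval-⟦⟧ v σ s)
  eval-⟦⟧ v σ (conj s t) = cong₂ _∧_ (eval-⟦⟧ v σ s) (eval-⟦⟧ v σ t)
  eval-⟦⟧ v σ (box () _ _)

allValuations : (n : ℕ) → (Vec Bool n → Bool) → Bool
allValuations zero    f = f []
allValuations (suc n) f = allValuations n (f ∘ (true ∷_)) ∧ allValuations n (f ∘ (false ∷_))

allValuations-sound : ∀ n f → T (allValuations n f) → ∀ ρ → T (f ρ)
allValuations-sound zero    f h [] = h
allValuations-sound (suc n) f h (true ∷ ρ) =
  allValuations-sound n _ (proj₁ (Equivalence.to T-∧ h)) ρ
allValuations-sound (suc n) f h (false ∷ ρ) =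
  allValuations-sound n _ (proj₂ (Equivalence.to T-∧ h)) ρ

ValidSchema : {n : ℕ} → Schema n → Set
ValidSchema {n} s = T (allValuations n (λ ρ → evalSchema ρ s))

tautology-⟦⟧ : {n : ℕ} {A M P : Set} (s : Schema n) → ValidSchema s →
               (σ : Vec (Formula A M P) n) → Tautology (s ⟦ σ ⟧)
tautology-⟦⟧ {n} s valid σ v =
  trans (eval-⟦⟧ v σ s) (Equivalence.to T-≡ (allValuations-sound n _ valid (map (eval v) σ)))

module _ {n : ℕ} where

  φ₀ : Schema (suc n)
  φ₀ = atom zero

  φ₁ : Schema (suc (suc n))
  φ₁ = atom (suc zero)

  φ₂ : Schema (suc (suc (suc n)))
  φ₂ = atom (suc (suc zero))

  φ₃ : Schema (suc (suc (suc (suc n))))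
  φ₃ = atom (suc (suc (suc zero)))

  φ₄ : Schema (suc (suc (suc (suc (suc n)))))
  φ₄ = atom (suc (suc (suc (suc zero))))

  φ₅ : Schema (suc (suc (suc (suc (suc (suc n))))))
  φ₅ = atom (suc (suc (suc (suc (suc zero)))))

module Modality {A M P : Set} (ag : A → M) (k : A → M → P) (a₀ : A)
                (Γ₁ : Formula A M P → Set) (m : M) (a : A) where
  open LDiiP ag k a₀

  □ : Formula A M P → Formula A M P
  □ = box m a

  infix 2 ⊢_
  ⊢_ : Formula A M P → Set
  ⊢ φ = Γ₁ ⊢ φ

  ⊢-tautology : {n : ℕ} (s : Schema n) {valid : ValidSchema s}
                (σ : Vec (Formula A M P) n) → ⊢ s ⟦ σ ⟧
  ⊢-tautology s {valid} σ = taut (tautology-⟦⟧ s valid σ)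

  ⇒-trans : ∀ {φ ψ χ} → ⊢ φ ⇒ ψ → ⊢ ψ ⇒ χ → ⊢ φ ⇒ χ
  ⇒-trans {φ} {ψ} {χ} p q =
    mp (mp (⊢-tautology ((φ₀ ⇒ φ₁) ⇒ ((φ₁ ⇒ φ₂) ⇒ (φ₀ ⇒ φ₂))) (φ ∷ ψ ∷ χ ∷ [])) p) q

  contraposition : ∀ {φ ψ} → ⊢ neg ψ ⇒ neg φ → ⊢ φ ⇒ ψ
  contraposition {φ} {ψ} =
    mp (⊢-tautology ((neg φ₀ ⇒ neg φ₁) ⇒ (φ₁ ⇒ φ₀)) (ψ ∷ φ ∷ []))

  contraposition-¬ : ∀ {φ ψ} → ⊢ neg ψ ⇒ φ → ⊢ neg φ ⇒ ψ
  contraposition-¬ {φ} {ψ} =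
    mp (⊢-tautology ((neg φ₀ ⇒ φ₁) ⇒ (neg φ₁ ⇒ φ₀)) (ψ ∷ φ ∷ []))

  □-mono : ∀ {φ ψ} → ⊢ φ ⇒ ψ → ⊢ □ φ ⇒ □ ψ
  □-mono {φ} {ψ} p = mp (K m a φ ψ) (nec m a p)

  □-mono₂ : ∀ {φ ψ χ} → ⊢ φ ⇒ (ψ ⇒ χ) → ⊢ □ φ ⇒ (□ ψ ⇒ □ χ)
  □-mono₂ {φ} {ψ} {χ} p = ⇒-trans (□-mono p) (K m a ψ χ)

  ¬□⇒□¬ : ∀ φ → ⊢ neg (□ φ) ⇒ □ (neg φ)
  ¬□⇒□¬ = negcompl m a

  □⇒¬□¬ : ∀ φ → ⊢ □ φ ⇒ neg (□ (neg φ))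
  □⇒¬□¬ φ = mp (mp (⊢-tautology ((φ₀ ⇒ (φ₁ ⇒ φ₂)) ⇒ (neg φ₂ ⇒ (φ₀ ⇒ neg φ₁)))
                                (□ φ ∷ □ (neg φ) ∷ □ ⊥f ∷ []))
                   (□-mono₂ (⊢-tautology (φ₀ ⇒ (neg φ₀ ⇒ neg φ₁)) (φ ∷ ⊤f ∷ []))))
               (cons m a)

  □¬⇒¬□ : ∀ φ → ⊢ □ (neg φ) ⇒ neg (□ φ)
  □¬⇒¬□ φ = mp (⊢-tautology ((φ₀ ⇒ neg φ₁) ⇒ (φ₁ ⇒ neg φ₀)) (□ φ ∷ □ (neg φ) ∷ []))
               (□⇒¬□¬ φ)

  □□⇒□ : ∀ φ → ⊢ □ (□ φ) ⇒ □ φ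
  □□⇒□ φ = mp (mp (⊢-tautology ((φ₀ ⇒ (φ₁ ⇒ φ₂)) ⇒ (φ₁ ⇒ (φ₀ ⇒ φ₂)))
                               (□ (□ φ) ∷ □ (kn a m) ∷ □ φ ∷ []))
                  (□-mono₂ (truth m a φ)))
              (selfK m a)

  □⇒□□ : ∀ φ → ⊢ □ φ ⇒ □ (□ φ)
  □⇒□□ φ = contraposition
    (⇒-trans (¬□⇒□¬ (□ φ)) (⇒-trans (□-mono (¬□⇒□¬ φ)) (⇒-trans (□□⇒□ (neg φ)) (□¬⇒¬□ φ))))

  ¬□⇒□¬□ : ∀ φ → ⊢ neg (□ φ) ⇒ □ (neg (□ φ))
  ¬□⇒□¬□ φ = contraposition-¬
    (⇒-trans (¬□⇒□¬ (neg (□ φ)))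
      (⇒-trans (□-mono (⊢-tautology (neg (neg φ₀) ⇒ φ₀) (□ φ ∷ []))) (□□⇒□ φ)))

  □¬⇒□¬⇒□¬∨ : ∀ φ ψ → ⊢ □ (neg φ) ⇒ (□ (neg ψ) ⇒ □ (neg (φ ∨ ψ)))
  □¬⇒□¬⇒□¬∨ φ ψ = □-mono₂ (⊢-tautology (neg φ₀ ⇒ (neg φ₁ ⇒ neg (φ₀ ∨ φ₁))) (φ ∷ ψ ∷ []))

  □∨⇒∨□ : ∀ φ ψ → ⊢ □ (φ ∨ ψ) ⇒ (□ φ ∨ □ ψ)
  □∨⇒∨□ φ ψ =
    mp (mp (mp (mp (⊢-tautology ((neg φ₀ ⇒ φ₂) ⇒ ((neg φ₁ ⇒ φ₃) ⇒ ((φ₂ ⇒ (φ₃ ⇒ φ₄))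
                                  ⇒ ((φ₄ ⇒ neg φ₅) ⇒ (φ₅ ⇒ (φ₀ ∨ φ₁))))))
                                (□ φ ∷ □ ψ ∷ □ (neg φ) ∷ □ (neg ψ) ∷ □ (neg (φ ∨ ψ)) ∷ □ (φ ∨ ψ) ∷ []))
                   (¬□⇒□¬ φ))
               (¬□⇒□¬ ψ))
           (□¬⇒□¬⇒□¬∨ φ ψ))
       (□¬⇒¬□ (φ ∨ ψ))

  negComplDisjKD45 : NegComplDisjKD45 Γ₁ m a
  negComplDisjKD45 =
    K m a , cons m a , □⇒□□ , ¬□⇒□¬□ , (λ _ → nec m a) , negcompl m a , □∨⇒∨□

corollary2 : {A M P : Set} → Finite A → Countable P →
    (a₀ : A) → (ag : A → M) → Injective _≡_ _≡_ ag →
    (k : A → M → P) →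
    (∀ a a' m m' → k a m ≡ k a' m' → (a ≡ a') × (m ≡ m')) →
    (Γ₁ : Formula A M P → Set) →
    (a : A) → (m : M) → LDiiP.NegComplDisjKD45 ag k a₀ Γ₁ m a
corollary2 _ _ a₀ ag _ k _ Γ₁ a m = Modality.negComplDisjKD45 ag k a₀ Γ₁ m a
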